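{- Let $\pi\in\mathfrak{S}_n$ be indecomposable, $G=G_\pi$, $s\in[n]$ a sink, $T$ a spanning tree of $G$ rooted at $s$, and $\prec_T$ the order on $E(G)$ defined below. If an edge $\{i,j\}$ of $G$ is externally active for $\prec_T$, then $|h(i)-h(j)|\le1$.
   Context: $G_\pi$: vertex set $[n]$, $a<b$ adjacent iff $b$ appears before $a$ in $\pi$. $h(i)$ is the distance from $i$ to $s$ in $T$. The order $\prec_T$: visit the vertices of $T$ by increasing height, and within a height in decreasing order of labels; when visiting $v$, the edges $\{v,w\}$ of $G$ with $w$ not yet visited are appended after all previously ordered edges, ordered among themselves by $\{v,w\}\prec_T\{v,w'\}$ iff $w>w'$. An edge $e\notin T$ is externally active for $\prec_T$ if it is the $\prec_T$-maximal edge of the unique cycle contained in $T\cup\{e\}$. -}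

module Defs where

open import Data.Nat using (ℕ; zero; suc; _≤_; _<_)
open import Data.Fin using (Fin; toℕ) renaming (_<_ to _<ᶠ_)
open import Data.Fin.Permutation using (Permutation′; _⟨$⟩ʳ_; _⟨$⟩ˡ_)
open import Data.List using (List; []; _∷_; _++_; [_]; zip; length)
open import Data.List.Relation.Unary.All using (All)
open import Data.List.Relation.Unary.Unique.Propositional using (Unique)
open import Data.Product using (_×_; _,_; Σ; ∃)
open import Data.Sum using (_⊎_)
open import Relation.Binary.PropositionalEquality using (_≡_)
open import Relation.Nullary using (¬_)

-- Vertices are Fin n (standing for [n]); a permutation π ∈ S_n in one-line
-- notation π(1)…π(n) is  π ⟨$⟩ʳ (position) = value ; the position of a
-- value b is  π ⟨$⟩ˡ b.

Rel : ℕ → Set₁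
Rel n = Fin n → Fin n → Set

-- π is indecomposable: there is no k with 1 ≤ k < n and π([k]) = [k]
-- (for a bijection of the finite set, π([k]) ⊆ [k] is the same as equality).
Indecomposable : ∀ {n} → Permutation′ n → Set
Indecomposable {n} π =
  ∀ (k : ℕ) → 0 < k → k < n →
    ¬ (∀ (i : Fin n) → toℕ i < k → toℕ (π ⟨$⟩ʳ i) < k)

Adj : ∀ {n} → Permutation′ n → Rel n
Adj π a b =
    (a <ᶠ b × (π ⟨$⟩ˡ b) <ᶠ (π ⟨$⟩ˡ a))
  ⊎ (b <ᶠ a × (π ⟨$⟩ˡ a) <ᶠ (π ⟨$⟩ˡ b))

data Walk {n} (R : Rel n) : Fin n → Fin n → ℕ → Set where
  nil  : ∀ {v} → Walk R v v 0
  cons : ∀ {u w v k} → R u w → Walk R w v k → Walk R u v (suc k)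

rotate : ∀ {A : Set} → List A → List A
rotate []       = []
rotate (x ∷ xs) = xs ++ [ x ]

closedPairs : ∀ {A : Set} → List A → List (A × A)
closedPairs xs = zip xs (rotate xs)

record Cycle {n} (R : Rel n) : Set where
  field
    verts : List (Fin n)
    distinct : Unique verts
    long : 3 ≤ length verts
    edges-in : All (λ p → R (Data.Product.proj₁ p) (Data.Product.proj₂ p))
                   (closedPairs verts)

record SpanningTree {n} (G T : Rel n) : Set where
  field
    sub  : ∀ {a b} → T a b → G a b
    symm : ∀ {a b} → T a b → T b a
    connected : ∀ (u v : Fin n) → ∃ λ k → Walk T u v k
    acyclic : ¬ Cycle T

IsHeight : ∀ {n} → Rel n → Fin n → (Fin n → ℕ) → Set
IsHeight T s h = ∀ i → Walk T i s (h i) × (∀ k → Walk T i s k → h i ≤ k)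

-- The visiting order of vertices: by increasing height, and within a height
-- by decreasing label.  VisitedBefore h v w : v is visited strictly before w.
VisitedBefore : ∀ {n} → (Fin n → ℕ) → Fin n → Fin n → Set
VisitedBefore h v w = h v < h w ⊎ (h v ≡ h w × w <ᶠ v)

-- An edge {v,w} is listed when visiting its earlier-visited endpoint v.
-- {a,b} ≺_T {c,d}: with u the earlier endpoint of {a,b} (other endpoint x)
-- and u' the earlier endpoint of {c,d} (other endpoint x'), either u is
-- visited before u', or u = u' and x > x'.
EdgeLt : ∀ {n} → (Fin n → ℕ) → (Fin n × Fin n) → (Fin n × Fin n) → Set
EdgeLt {n} h (a , b) (c , d) =
  Σ (Fin n) λ u → Σ (Fin n) λ x → Σ (Fin n) λ u' → Σ (Fin n) λ x' →
    (((u ≡ a × x ≡ b) ⊎ (u ≡ b × x ≡ a)) × VisitedBefore h u x) ×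
    (((u' ≡ c × x' ≡ d) ⊎ (u' ≡ d × x' ≡ c)) × VisitedBefore h u' x') ×
    (VisitedBefore h u u' ⊎ (u ≡ u' × x' <ᶠ x))

SameEdge : ∀ {n} → (Fin n × Fin n) → (Fin n × Fin n) → Set
SameEdge (a , b) (c , d) = (a ≡ c × b ≡ d) ⊎ (a ≡ d × b ≡ c)

AddEdge : ∀ {n} → Rel n → Fin n → Fin n → Rel n
AddEdge T i j x y = T x y ⊎ SameEdge (x , y) (i , j)

-- The edge {i,j} ∉ T of G is externally active for ≺_T: it is the ≺_T-maximal
-- edge of the (unique) cycle contained in T ∪ {e}, i.e. every other edge of
-- that cycle is ≺_T-smaller.  (Quantifying over all cycles of T ∪ {e} is
-- faithful since that cycle exists and is unique.)
ExternallyActive : ∀ {n} → Permutation′ n → Rel n → (Fin n → ℕ) →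
                   Fin n → Fin n → Set
ExternallyActive π T h i j =
  Adj π i j × ¬ T i j ×
  (∀ (C : Cycle (AddEdge T i j)) →
     All (λ f → SameEdge f (i , j) ⊎ EdgeLt h f (i , j))
         (closedPairs (Cycle.verts C)))

module Submission where

open import Defs
open import Data.Nat using (ℕ; suc; _≤_; _<_; _⊓_; z≤n; s≤s)
open import Data.Nat.Properties
  using (≤-refl; ≤-trans; ≤-pred; <⇒≤; <⇒≱; 1+n≰n; n≮n; ≤-reflexive; ≮⇒≥; m≤n⇒m⊓n≡m; m≥n⇒m⊓n≡n; ⊓-comm; ⊓-glb;
         m⊓n≤m; module ≤-Reasoning)
open import Data.Fin using (Fin; _≟_) renaming (_<_ to _<ᶠ_)
open import Data.Fin.Permutation using (Permutation′)
open import Data.Product using (_×_; _,_; ∃; proj₁; proj₂)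
open import Data.Sum using (_⊎_; inj₁; inj₂)
open import Data.List using (List; []; _∷_; _++_; [_]; zip; length)
open import Data.List.Relation.Unary.All as All using (All; []; _∷_)
open import Data.List.Relation.Unary.All.Properties using (¬Any⇒All¬)
open import Data.List.Relation.Unary.Any using (here; there)
open import Data.List.Relation.Unary.AllPairs using ([]; _∷_)
open import Data.List.Relation.Unary.Unique.Propositional using (Unique)
open import Relation.Nullary using (¬_; yes; no)
open import Relation.Binary.PropositionalEquality using (_≡_; refl; sym)

-- Suppose {a,b} is externally active but h a ≥ h b + 2. Close the tree path
-- a = v₀, v₁, …, b with the edge {b,a} into a cycle of T ∪ {a,b}. Heights
-- change by at most one along tree edges, so both ends of {a,v₁} lie strictly
-- above b; hence {a,v₁} is visited after {a,b} (whose earlier end is b), i.e.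
-- {a,v₁} is ≺_T-larger, contradicting maximality.

module _ {n : ℕ} (R : Rel n) where

  open import Data.List.Membership.DecPropositional (_≟_ {n}) using (_∈_; _∈?_)

  data Path : Fin n → Fin n → List (Fin n) → Set where
    end  : ∀ {v} → Path v v []
    step : ∀ {u w v xs} → R u w → Path w v xs → Path u v (w ∷ xs)

  pathSuffix : ∀ {u w v xs} → Path w v xs → Unique (w ∷ xs) → u ∈ w ∷ xs →
               ∃ λ ys → Path u v ys × Unique (u ∷ ys)
  pathSuffix p          q       (here refl) = _ , p , q
  pathSuffix (step _ p) (_ ∷ q) (there u∈)  = pathSuffix p q u∈

  walk⇒simplePath : ∀ {u v k} → Walk R u v k → ∃ λ xs → Path u v xs × Unique (u ∷ xs)
  walk⇒simplePath nil = [] , end , [] ∷ []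
  walk⇒simplePath {u} (cons r walk) with walk⇒simplePath walk
  ... | xs , p , q with u ∈? _ ∷ xs
  ...   | yes u∈ = pathSuffix p q u∈
  ...   | no u∉  = _ , step r p , ¬Any⇒All¬ _ u∉ ∷ q

  closedPath-edges : ∀ {R′ : Rel n} {u v xs} a → (∀ {x y} → R x y → R′ x y) → R′ v a →
                     Path u v xs → All (λ p → R′ (proj₁ p) (proj₂ p)) (zip (u ∷ xs) (xs ++ [ a ]))
  closedPath-edges a R⊆R′ r′ end        = r′ ∷ []
  closedPath-edges a R⊆R′ r′ (step r p) = R⊆R′ r ∷ closedPath-edges a R⊆R′ r′ p

  pathCycle : ∀ {R′ : Rel n} {a b xs} → (∀ {x y} → R x y → R′ x y) → R′ b a →
              Path a b xs → Unique (a ∷ xs) → 2 ≤ length xs → Cycle R′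
  pathCycle {a = a} {xs = xs} R⊆R′ r′ p q long = record
    { verts    = a ∷ xs
    ; distinct = q
    ; long     = s≤s long
    ; edges-in = closedPath-edges a R⊆R′ r′ p
    }

module _ {n : ℕ} (h : Fin n → ℕ) where

  minHeight : Fin n × Fin n → ℕ
  minHeight (a , b) = h a ⊓ h b

  visitedBefore⇒height≤ : ∀ {u x} → VisitedBefore h u x → h u ≤ h x
  visitedBefore⇒height≤ (inj₁ h<)       = <⇒≤ h<
  visitedBefore⇒height≤ (inj₂ (h≡ , _)) = ≤-reflexive h≡

  earlierEnd-height : ∀ {a b u x} → (u ≡ a × x ≡ b) ⊎ (u ≡ b × x ≡ a) →
                      VisitedBefore h u x → h u ≡ minHeight (a , b)
  earlierEnd-height (inj₁ (refl , refl)) vb = sym (m≤n⇒m⊓n≡m (visitedBefore⇒height≤ vb))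
  earlierEnd-height (inj₂ (refl , refl)) vb = sym (m≥n⇒m⊓n≡n (visitedBefore⇒height≤ vb))

  sameEdge⇒minHeight≡ : ∀ {f e} → SameEdge f e → minHeight f ≡ minHeight e
  sameEdge⇒minHeight≡ (inj₁ (refl , refl)) = refl
  sameEdge⇒minHeight≡ {a , b} (inj₂ (refl , refl)) = ⊓-comm (h a) (h b)

  edgeLt⇒minHeight≤ : ∀ {f e} → EdgeLt h f e → minHeight f ≤ minHeight e
  edgeLt⇒minHeight≤ {f} {e} (u , x , u′ , x′ , (ux , vb) , (ux′ , vb′) , u≼u′) = begin
    minHeight f ≡⟨ sym (earlierEnd-height ux vb) ⟩
    h u         ≤⟨ earlierVisited u≼u′ ⟩
    h u′        ≡⟨ earlierEnd-height ux′ vb′ ⟩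
    minHeight e ∎
    where
    open ≤-Reasoning
    earlierVisited : ∀ {v v′ y y′} → VisitedBefore h v v′ ⊎ (v ≡ v′ × y′ <ᶠ y) → h v ≤ h v′
    earlierVisited (inj₁ vb″)       = visitedBefore⇒height≤ vb″
    earlierVisited (inj₂ (refl , _)) = ≤-refl

  sameEdgeOrEdgeLt⇒minHeight≤ : ∀ {f e} → SameEdge f e ⊎ EdgeLt h f e → minHeight f ≤ minHeight e
  sameEdgeOrEdgeLt⇒minHeight≤ (inj₁ f≈e) = ≤-reflexive (sameEdge⇒minHeight≡ f≈e)
  sameEdgeOrEdgeLt⇒minHeight≤ (inj₂ f<e) = edgeLt⇒minHeight≤ f<e

height-step : ∀ {n} {T : Rel n} {s h} → IsHeight T s h → ∀ {u w} → T u w → h u ≤ suc (h w)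
height-step height r = proj₂ (height _) _ (cons r (proj₁ (height _)))

maximalEdge⇒heightGap≤1 :
  ∀ {n} {T : Rel n} {h : Fin n → ℕ} {i j a b} →
  (∀ {u w} → T u w → h u ≤ suc (h w)) → (∀ u v → ∃ λ k → Walk T u v k) →
  (∀ (C : Cycle (AddEdge T i j)) →
     All (λ f → SameEdge f (i , j) ⊎ EdgeLt h f (i , j)) (closedPairs (Cycle.verts C))) →
  SameEdge (b , a) (i , j) → h a ≤ suc (h b)
maximalEdge⇒heightGap≤1 {T = T} {h} {i} {j} {a} {b} h-step connected maximal ba≈ij =
  ≮⇒≥ λ gap → noSimplePath gap (walk⇒simplePath T (proj₂ (connected a b)))
  where
  noSimplePath : suc (h b) < h a → ¬ ∃ λ xs → Path T a b xs × Unique (a ∷ xs)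
  noSimplePath gap (_ , end , _)        = 1+n≰n (<⇒≤ gap)
  noSimplePath gap (_ , step r end , _)         = <⇒≱ gap (h-step r)
  noSimplePath gap (_ , path@(step {w = v} r (step _ _)) , unique) = n≮n (h b) (begin-strict
    h b                 <⟨ ⊓-glb (<⇒≤ gap) (≤-pred (≤-trans gap (h-step r))) ⟩
    minHeight h (a , v) ≤⟨ sameEdgeOrEdgeLt⇒minHeight≤ h (All.head (maximal cycle)) ⟩
    minHeight h (i , j) ≡⟨ sym (sameEdge⇒minHeight≡ h ba≈ij) ⟩
    h b ⊓ h a           ≤⟨ m⊓n≤m (h b) (h a) ⟩
    h b                 ∎)
    where
    open ≤-Reasoning
    cycle : Cycle (AddEdge T i j)
    cycle = pathCycle T inj₁ (inj₂ ba≈ij) path unique (s≤s (s≤s z≤n))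

lemma3p10 : ∀ {n} (π : Permutation′ n) → Indecomposable π →
    (s : Fin n) (T : Rel n) → SpanningTree (Adj π) T →
    (h : Fin n → ℕ) → IsHeight T s h →
    (i j : Fin n) → ExternallyActive π T h i j →
    (h i ≤ suc (h j)) × (h j ≤ suc (h i))
lemma3p10 π _ s T tree h height i j (_ , _ , maximal) =
    maximalEdge⇒heightGap≤1 (height-step height) connected maximal (inj₂ (refl , refl))
  , maximalEdge⇒heightGap≤1 (height-step height) connected maximal (inj₁ (refl , refl))
  where open SpanningTree tree
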